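{- Fix reals $C\ge 1$, $0<\alpha\le 1$, $\lambda>1$, and positive integers $t,a,p,q,n$ such that (1) $1/t<\alpha$ and $a>C$; (2) $p$ is a multiple of $a^t$; (3) $q^t\ge\lambda^p$; (4) $n\ge p+p(q-1)\sum_{j=1}^{t}(q/a)^{t-j}$. Then for each $i\in\{1,\dots,t\}$ there is a set $K\subseteq\{0,1\}^n$ of vectors all of Hamming weight $p$ such that $K$ is a $\mathcal{C}_i$-set.
   Context: The Hamming weight of $v\in\{0,1\}^n$ is the sum of its coordinates; the Hamming distance $\rho(u,v)$ is the number of coordinates where $u,v$ differ. With $t,a,p,q$ as in the claim, $\mathcal{C}_i$-sets are defined recursively: a set $L\subseteq\{0,1\}^n$ is a $\mathcal{C}_0$-set if it consists of a single vector. For $i\in\{1,\dots,t\}$, $L$ is a $\mathcal{C}_i$-set if (a) $|L|=q^i$; (b) $\max\{\rho(x,y): x,y\in L\}=2p/a^{t-i}$; (c) $L$ can be partitioned into $q$ sets $L_1,\dots,L_q$ such that each $L_r$ is a $\mathcal{C}_{i-1}$-set and $\rho(x,y)=2p/a^{t-i}$ for all $x\in L_r$, $y\in L_s$ with $r\ne s$.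
   Formalization: The constants C, α and λ are taken in the rationals rather than the reals. -}

module Defs where

open import Data.Bool using (Bool; true; false)
open import Data.Nat as ℕ using (ℕ; zero; suc; _+_; _*_; _∸_; _^_; _≤_)
open import Data.Integer using (+_)
open import Data.Rational as ℚ using (ℚ; 0ℚ; 1ℚ)
open import Data.Fin using (Fin)
open import Data.Vec using (Vec; countᵇ; zipWith)
open import Data.List using (List; [_]; length; concat; tabulate)
open import Data.List.Membership.Propositional using (_∈_)
open import Data.List.Relation.Unary.Unique.Propositional using (Unique)
open import Data.List.Relation.Binary.Permutation.Propositional using (_↭_)
open import Data.Product using (Σ; _×_; ∃; ∃-syntax)
open import Relation.Binary.PropositionalEquality using (_≡_; _≢_)

-- the natural number m/d as a rational (d > 0 in every use; value 0 for d = 0 is irrelevant)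
fracℕ : ℕ → ℕ → ℚ
fracℕ m zero    = 0ℚ
fracℕ m (suc d) = (+ m) ℚ./ suc d

toℚ : ℕ → ℚ
toℚ m = fracℕ m 1

infixr 8 _^ℚ_
_^ℚ_ : ℚ → ℕ → ℚ
x ^ℚ zero  = 1ℚ
x ^ℚ suc k = x ℚ.* (x ^ℚ k)

sum1to : ℕ → (ℕ → ℚ) → ℚ
sum1to zero    f = 0ℚ
sum1to (suc k) f = sum1to k f ℚ.+ f (suc k)

weight : ∀ {n} → Vec Bool n → ℕ
weight v = countᵇ (λ b → b) v

xor : Bool → Bool → Bool
xor true  true  = false
xor true  false = true
xor false true  = true
xor false false = false

ρ : ∀ {n} → Vec Bool n → Vec Bool n → ℕ
ρ u v = weight (zipWith xor u v)

-- A finite set L ⊆ {0,1}^n is a duplicate-free list.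
-- The distance 2p / a^(t-i) is expressed multiplicatively: ρ(x,y) = 2p/a^(t-i) iff
-- ρ(x,y) * a^(t-i) = 2p (a > 0), and ρ ≤ 2p/a^(t-i) iff ρ * a^(t-i) ≤ 2p.
module _ {n : ℕ} (t a p q : ℕ) where

  IsDist : ℕ → Vec Bool n → Vec Bool n → Set
  IsDist i x y = ρ x y * a ^ (t ∸ i) ≡ 2 * p

  MaxDist : ℕ → List (Vec Bool n) → Set
  MaxDist i L = (∀ {x y} → x ∈ L → y ∈ L → ρ x y * a ^ (t ∸ i) ≤ 2 * p)
              × (∃[ x ] ∃[ y ] (x ∈ L × y ∈ L × IsDist i x y))

  IsCSet : ℕ → List (Vec Bool n) → Set
  IsCSet zero    L = ∃[ v ] (L ≡ [ v ])
  IsCSet (suc i) L =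
      Unique L
    × length L ≡ q ^ suc i
    × MaxDist (suc i) L
    × Σ (Fin q → List (Vec Bool n)) λ parts →
          (concat (tabulate parts) ↭ L)
        × (∀ r → IsCSet i (parts r))
        × (∀ r s → r ≢ s → ∀ {x y} → x ∈ parts r → y ∈ parts s → IsDist (suc i) x y)

module Submission where

-- Write p = c·aᵗ and h_j = c·aʲ.  Start from W₀ = {1ᶜ}.  W_{j+1} arises from W_j by
-- appending (a-1)·h_j ones to every vector (so all weights become h_{j+1}) and placing
-- a copy of the result in each of q disjoint coordinate blocks; the q copies are the
-- parts.  Inside a block distances are unchanged, across blocks they equal
-- 2h_{j+1} = 2p/a^{t-j-1}, and this is also the maximal distance because
-- ρ(x,y) ≤ |x| + |y|.  So W_j is a C_j-set as soon as q ≥ 2, which follows from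
-- λ^p ≤ qᵗ with λ > 1.  Finally every vector of W_i is padded by p - h_i ones and by
-- zeros up to length n; padding is an isometry, so this gives a C_i-set of weight-p
-- vectors.  There is room for the padding: the length N_i of W_i satisfies
-- N_i - h_i ≤ (q-1)·Σ_{j≤t} q^{t-j}·h_j, and since p·(q/a)^{t-j} = q^{t-j}·h_j,
-- hypothesis (4) says exactly p + (q-1)·Σ_{j≤t} q^{t-j}·h_j ≤ n.

open import Defs
open import Data.Bool using (Bool; true; false)
open import Data.Nat using (ℕ; zero; suc; _+_; _*_; _<_; _≤_; _^_; _∸_; _≤′_; ≤′-refl; ≤′-step; s≤s; z≤n;
                           >-nonZero; >-nonZero⁻¹)
open import Data.Nat.Properties
  using ( +-identityʳ; +-assoc; +-comm; +-suc; *-identityʳ; *-identityˡ; *-zeroʳ; *-assoc; *-distribˡ-+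
        ; ≤-refl; ≤-trans; ≤-reflexive; n≤1+n; m≤m+n; m≤n⇒m≤1+n; m≤m*n; m≤n*m; ≤⇒≤′; <⇒≢
        ; +-monoʳ-≤; *-monoˡ-≤; *-monoʳ-≤; *-mono-<; m≤n⇒∃[o]m+o≡n; m+[n∸m]≡n; +-∸-assoc
        ; ^-distribˡ-+-*; ^-zeroˡ; m^n>0; m^n≢0; m*n≢0⇒m≢0; module ≤-Reasoning)
open import Data.Nat.Tactic.RingSolver using (solve-∀)
open import Data.Nat.Divisibility using (_∣_; divides)
import Data.Integer as ℤ
import Data.Integer.Properties as ℤ
import Data.Integer.Tactic.RingSolver as ℤ-Solver
open import Data.Rational using (ℚ; 1ℚ; 0ℚ; toℚᵘ; Positive; positive)
  renaming (_<_ to _<ℚ_; _≤_ to _≤ℚ_; _+_ to _+ℚ_; _*_ to _*ℚ_; _-_ to _-ℚ_)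
import Data.Rational.Properties as ℚ
open import Data.Rational.Solver using (module +-*-Solver)
open import Data.Rational.Unnormalised as ℚᵘ using (ℚᵘ; mkℚᵘ; *≡*)
import Data.Rational.Unnormalised.Properties as ℚᵘ
open import Data.Fin using (Fin; zero; suc)
open import Data.Vec using (Vec; []; _∷_; _++_; replicate)
open import Data.List using (List; [_]; length; map; concat; tabulate)
open import Data.List.Properties using (length-map; length-++; concat-map; map-tabulate)
open import Data.List.Membership.Propositional using (_∈_)
open import Data.List.Membership.Propositional.Properties using (∈-map⁺; ∈-map⁻; ∈-concat⁺)
open import Data.List.Relation.Unary.Any using (here)
import Data.List.Relation.Unary.Any.Properties as Any
open import Data.List.Relation.Unary.All as All using (All; []; _∷_)
import Data.List.Relation.Unary.All.Properties as All
open import Data.List.Relation.Unary.AllPairs using ([]; _∷_)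
import Data.List.Relation.Unary.AllPairs.Properties as AllPairs
open import Data.List.Relation.Unary.Unique.Propositional using (Unique)
import Data.List.Relation.Unary.Unique.Propositional.Properties as Unique
open import Data.List.Relation.Binary.Disjoint.Propositional using (Disjoint)
open import Data.List.Relation.Binary.Permutation.Propositional using (↭-refl; ↭-reflexive; ↭-trans)
import Data.List.Relation.Binary.Permutation.Propositional.Properties as Perm
open import Data.Product using (_×_; _,_; proj₁; proj₂; ∃-syntax)
open import Data.Empty using (⊥-elim)
open import Relation.Binary.PropositionalEquality
  using (_≡_; _≢_; refl; sym; trans; cong; cong₂; subst; subst₂; module ≡-Reasoning)


weight-++ : ∀ {m n} (u : Vec Bool m) (v : Vec Bool n) → weight (u ++ v) ≡ weight u + weight v
weight-++ []          v = refl
weight-++ (true ∷ u)  v = cong suc (weight-++ u v)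
weight-++ (false ∷ u) v = weight-++ u v

weight-ones : ∀ k → weight (replicate k true) ≡ k
weight-ones zero    = refl
weight-ones (suc k) = cong suc (weight-ones k)

weight-zeros : ∀ k → weight (replicate k false) ≡ 0
weight-zeros zero    = refl
weight-zeros (suc k) = weight-zeros k

ρ-++ : ∀ {m n} (u u' : Vec Bool m) (v v' : Vec Bool n) → ρ (u ++ v) (u' ++ v') ≡ ρ u u' + ρ v v'
ρ-++ []          []           v v' = refl
ρ-++ (true ∷ u)  (true ∷ u')  v v' = ρ-++ u u' v v'
ρ-++ (true ∷ u)  (false ∷ u') v v' = cong suc (ρ-++ u u' v v')
ρ-++ (false ∷ u) (true ∷ u')  v v' = cong suc (ρ-++ u u' v v')
ρ-++ (false ∷ u) (false ∷ u') v v' = ρ-++ u u' v v'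

ρ-self : ∀ {n} (v : Vec Bool n) → ρ v v ≡ 0
ρ-self []          = refl
ρ-self (true ∷ v)  = ρ-self v
ρ-self (false ∷ v) = ρ-self v

ρ≡0⇒≡ : ∀ {n} (u v : Vec Bool n) → ρ u v ≡ 0 → u ≡ v
ρ≡0⇒≡ []          []          _  = refl
ρ≡0⇒≡ (true ∷ u)  (true ∷ v)  eq = cong (true ∷_) (ρ≡0⇒≡ u v eq)
ρ≡0⇒≡ (false ∷ u) (false ∷ v) eq = cong (false ∷_) (ρ≡0⇒≡ u v eq)
ρ≡0⇒≡ (true ∷ u)  (false ∷ v) ()
ρ≡0⇒≡ (false ∷ u) (true ∷ v)  ()

ρ-zerosˡ : ∀ {n} (v : Vec Bool n) → ρ (replicate n false) v ≡ weight v
ρ-zerosˡ []          = refl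
ρ-zerosˡ (true ∷ v)  = cong suc (ρ-zerosˡ v)
ρ-zerosˡ (false ∷ v) = ρ-zerosˡ v

ρ-zerosʳ : ∀ {n} (v : Vec Bool n) → ρ v (replicate n false) ≡ weight v
ρ-zerosʳ []          = refl
ρ-zerosʳ (true ∷ v)  = cong suc (ρ-zerosʳ v)
ρ-zerosʳ (false ∷ v) = ρ-zerosʳ v

ρ-padʳ : ∀ {m n} (u v : Vec Bool m) (w : Vec Bool n) → ρ (u ++ w) (v ++ w) ≡ ρ u v
ρ-padʳ u v w = trans (ρ-++ u v w w) (trans (cong (ρ u v +_) (ρ-self w)) (+-identityʳ (ρ u v)))

ρ-padˡ : ∀ {m n} (w : Vec Bool m) (u v : Vec Bool n) → ρ (w ++ u) (w ++ v) ≡ ρ u v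
ρ-padˡ w u v = trans (ρ-++ w w u v) (cong (_+ ρ u v) (ρ-self w))

-- Triangle inequality through the zero vector; it bounds the diameter of a
-- set of vectors of equal weight.
ρ≤weight+weight : ∀ {n} (u v : Vec Bool n) → ρ u v ≤ weight u + weight v
ρ≤weight+weight []          []          = z≤n
ρ≤weight+weight (true ∷ u)  (true ∷ v)  =
  ≤-trans (ρ≤weight+weight u v) (≤-trans (+-monoʳ-≤ (weight u) (n≤1+n (weight v))) (n≤1+n _))
ρ≤weight+weight (true ∷ u)  (false ∷ v) = s≤s (ρ≤weight+weight u v)
ρ≤weight+weight (false ∷ u) (true ∷ v)  =
  ≤-trans (s≤s (ρ≤weight+weight u v)) (≤-reflexive (sym (+-suc (weight u) (weight v))))
ρ≤weight+weight (false ∷ u) (false ∷ v) = ρ≤weight+weight u v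

weight-subst : ∀ {m n} (m≡n : m ≡ n) (v : Vec Bool m) → weight (subst (Vec Bool) m≡n v) ≡ weight v
weight-subst refl v = refl

ρ-subst : ∀ {m n} (m≡n : m ≡ n) (u v : Vec Bool m) →
          ρ (subst (Vec Bool) m≡n u) (subst (Vec Bool) m≡n v) ≡ ρ u v
ρ-subst refl u v = refl

isometry-injective : ∀ {m m'} (f : Vec Bool m → Vec Bool m') → (∀ x y → ρ (f x) (f y) ≡ ρ x y) →
                     ∀ {x y} → f x ≡ f y → x ≡ y
isometry-injective f iso {x} {y} fx≡fy =
  ρ≡0⇒≡ x y (trans (sym (iso x y)) (subst (λ z → ρ (f x) z ≡ 0) fx≡fy (ρ-self (f x))))

place : ∀ {B} k → Fin k → Vec Bool B → Vec Bool (k * B)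
place {B} (suc k) zero    v = v ++ replicate (k * B) false
place {B} (suc k) (suc r) v = replicate B false ++ place k r v

weight-place : ∀ {B} k r (v : Vec Bool B) → weight (place k r v) ≡ weight v
weight-place {B} (suc k) zero    v =
  trans (weight-++ v (replicate (k * B) false)) (trans (cong (weight v +_) (weight-zeros (k * B))) (+-identityʳ _))
weight-place {B} (suc k) (suc r) v =
  trans (weight-++ (replicate B false) (place k r v)) (cong₂ _+_ (weight-zeros B) (weight-place k r v))

ρ-place-same : ∀ {B} k r (v w : Vec Bool B) → ρ (place k r v) (place k r w) ≡ ρ v w
ρ-place-same {B} (suc k) zero    v w = ρ-padʳ v w (replicate (k * B) false)
ρ-place-same {B} (suc k) (suc r) v w = trans (ρ-padˡ (replicate B false) _ _) (ρ-place-same k r v w)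

-- ... and vectors in different blocks have disjoint supports.
ρ-place-diff : ∀ {B} k r s → r ≢ s → (v w : Vec Bool B) → ρ (place k r v) (place k s w) ≡ weight v + weight w
ρ-place-diff     (suc k) zero    zero    r≢s v w = ⊥-elim (r≢s refl)
ρ-place-diff {B} (suc k) zero    (suc s) _   v w =
  trans (ρ-++ v (replicate B false) (replicate (k * B) false) (place k s w))
        (cong₂ _+_ (ρ-zerosʳ v) (trans (ρ-zerosˡ (place k s w)) (weight-place k s w)))
ρ-place-diff {B} (suc k) (suc r) zero    _   v w =
  trans (ρ-++ (replicate B false) w (place k r v) (replicate (k * B) false))
        (trans (cong₂ _+_ (ρ-zerosˡ w) (trans (ρ-zerosʳ (place k r v)) (weight-place k r v)))
               (+-comm (weight w) (weight v)))
ρ-place-diff {B} (suc k) (suc r) (suc s) r≢s v w =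
  trans (ρ-padˡ (replicate B false) (place k r v) (place k s w)) (ρ-place-diff k r s (λ r≡s → r≢s (cong suc r≡s)) v w)

inBlock : ∀ {m} q e → Fin q → Vec Bool m → Vec Bool (q * (m + e))
inBlock q e r w = place q r (w ++ replicate e true)

lift : ∀ {m} q e → List (Vec Bool m) → List (Vec Bool (q * (m + e)))
lift q e L = concat (tabulate (λ r → map (inBlock q e r) L))

weight-inBlock : ∀ {m} q e r (w : Vec Bool m) → weight (inBlock q e r w) ≡ weight w + e
weight-inBlock q e r w =
  trans (weight-place q r _) (trans (weight-++ w (replicate e true)) (cong (weight w +_) (weight-ones e)))

ρ-inBlock-same : ∀ {m} q e r (w w' : Vec Bool m) → ρ (inBlock q e r w) (inBlock q e r w') ≡ ρ w w'
ρ-inBlock-same q e r w w' = trans (ρ-place-same q r _ _) (ρ-padʳ w w' (replicate e true))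

lift-weights : ∀ {m} q e {h h'} {L : List (Vec Bool m)} → h + e ≡ h' →
               All (λ v → weight v ≡ h) L → All (λ v → weight v ≡ h') (lift q e L)
lift-weights q e {h} {h'} h+e≡h' weights =
  All.concat⁺ (All.tabulate⁺ (λ r → All.map⁺ {f = inBlock q e r} (All.map (block-weight r) weights)))
  where
  block-weight : ∀ r {w} → weight w ≡ h → weight (inBlock q e r w) ≡ h'
  block-weight r {w} w≡h = trans (weight-inBlock q e r w) (trans (cong (_+ e) w≡h) h+e≡h')

lift-cross : ∀ {m} q e {h h'} {L : List (Vec Bool m)} → h + e ≡ h' → All (λ v → weight v ≡ h) L →
             ∀ {r s} → r ≢ s → ∀ {x y} → x ∈ map (inBlock q e r) L → y ∈ map (inBlock q e s) L →
             ρ x y ≡ h' + h'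
lift-cross q e {h' = h'} {L} h+e≡h' weights {r} {s} r≢s x∈ y∈ with ∈-map⁻ (inBlock q e r) x∈ | ∈-map⁻ (inBlock q e s) y∈
... | w , w∈ , refl | w' , w'∈ , refl =
  trans (ρ-place-diff q r s r≢s _ _)
        (cong₂ _+_ (lifted-weight w∈) (lifted-weight w'∈))
  where
  lifted-weight : ∀ {v} → v ∈ L → weight (v ++ replicate e true) ≡ h'
  lifted-weight {v} v∈ = trans (weight-++ v (replicate e true))
                           (trans (cong₂ _+_ (All.lookup weights v∈) (weight-ones e)) h+e≡h')

module _ {A : Set} {k : ℕ} (f : Fin k → List A) where

  ∈-concatTab⁺ : ∀ {x} r → x ∈ f r → x ∈ concat (tabulate f)
  ∈-concatTab⁺ r x∈ = ∈-concat⁺ (Any.tabulate⁺ r x∈)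

  unique-concatTab : (∀ r → Unique (f r)) → (∀ {r s} → r ≢ s → Disjoint (f r) (f s)) →
                     Unique (concat (tabulate f))
  unique-concatTab unique disjoint = Unique.concat⁺ (All.tabulate⁺ unique) (AllPairs.tabulate⁺ disjoint)

length-concatTab : ∀ {A : Set} {k} (f : Fin k → List A) m → (∀ r → length (f r) ≡ m) →
                   length (concat (tabulate f)) ≡ k * m
length-concatTab {k = zero}  f m _   = refl
length-concatTab {k = suc k} f m len =
  trans (length-++ (f zero)) (cong₂ _+_ (len zero) (length-concatTab (λ r → f (suc r)) m (λ r → len (suc r))))

module CSets (t a p : ℕ) where

  module Isometry {m m'} (f : Vec Bool m → Vec Bool m') (iso : ∀ x y → ρ (f x) (f y) ≡ ρ x y) where

    inherit : ∀ (P : ℕ → Set) {A B} → (∀ {x y} → x ∈ A → y ∈ B → P (ρ x y)) →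
              ∀ {x y} → x ∈ map f A → y ∈ map f B → P (ρ x y)
    inherit P all x∈ y∈ with ∈-map⁻ f x∈ | ∈-map⁻ f y∈
    ... | x₀ , x₀∈ , refl | y₀ , y₀∈ , refl = subst P (sym (iso x₀ y₀)) (all x₀∈ y₀∈)

    map-concatTab : ∀ {k} (parts : Fin k → List (Vec Bool m)) →
                    concat (tabulate (λ r → map f (parts r))) ≡ map f (concat (tabulate parts))
    map-concatTab parts = trans (cong concat (sym (map-tabulate parts (map f)))) (concat-map (tabulate parts))

    preserves-CSet : ∀ {q} i {L} → IsCSet t a p q i L → IsCSet t a p q i (map f L)
    preserves-CSet zero (v , refl) = f v , refl
    preserves-CSet (suc i) {L} (unique , len , (bound , x , y , x∈ , y∈ , dist) , parts , perm , sub , cross) =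
        Unique.map⁺ (isometry-injective f iso) unique
      , trans (length-map f L) len
      , ( inherit (λ d → d * a ^ (t ∸ suc i) ≤ 2 * p) bound
        , f x , f y , ∈-map⁺ f x∈ , ∈-map⁺ f y∈
        , subst (λ d → d * a ^ (t ∸ suc i) ≡ 2 * p) (sym (iso x y)) dist)
      , (λ r → map f (parts r))
      , ↭-trans (↭-reflexive (map-concatTab parts)) (Perm.map⁺ f perm)
      , (λ r → preserves-CSet i (sub r))
      , (λ r s r≢s → inherit (λ d → d * a ^ (t ∸ suc i) ≡ 2 * p) (cross r s r≢s))

  CSet-unique : ∀ {m q} i {L : List (Vec Bool m)} → IsCSet t a p q i L → Unique L
  CSet-unique zero    (v , refl)   = [] ∷ []
  CSet-unique (suc i) (unique , _) = unique

  CSet-length : ∀ {m q} i {L : List (Vec Bool m)} → IsCSet t a p q i L → length L ≡ q ^ i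
  CSet-length zero    (v , refl)    = refl
  CSet-length (suc i) (_ , len , _) = len

  CSet-member : ∀ {m q} i {L : List (Vec Bool m)} → IsCSet t a p q i L → ∃[ x ] (x ∈ L)
  CSet-member zero    (v , refl)                         = v , here refl
  CSet-member (suc i) (_ , _ , (_ , x , _ , x∈ , _) , _) = x , x∈

  lift-CSet : ∀ {m q} i e h h' {L : List (Vec Bool m)} → 2 ≤ q → h + e ≡ h' → 0 < h' →
              (h' + h') * a ^ (t ∸ suc i) ≡ 2 * p →
              All (λ v → weight v ≡ h) L → IsCSet t a p q i L →
              All (λ v → weight v ≡ h') (lift q e L) × IsCSet t a p q (suc i) (lift q e L)
  lift-CSet {m} {q@(suc (suc _))} i e h h' {L} (s≤s (s≤s z≤n)) h+e≡h' 0<h' scale weights cset =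
      lifted-weights
    , ( unique-concatTab part (λ r → Unique.map⁺ (isometry-injective _ (ρ-inBlock-same q e r)) (CSet-unique i cset))
                         disjoint
      , length-concatTab part (q ^ i) (λ r → trans (length-map (inBlock q e r) L) (CSet-length i cset))
      , ( (λ x∈ y∈ → ≤-trans (*-monoˡ-≤ (a ^ (t ∸ suc i)) (bounded x∈ y∈)) (≤-reflexive scale))
        , inBlock q e zero w , inBlock q e (suc zero) w
        , ∈-concatTab⁺ part zero (∈-map⁺ (inBlock q e zero) w∈)
        , ∈-concatTab⁺ part (suc zero) (∈-map⁺ (inBlock q e (suc zero)) w∈)
        , at-distance {zero} {suc zero} (λ ()) (∈-map⁺ (inBlock q e zero) w∈) (∈-map⁺ (inBlock q e (suc zero)) w∈))
      , part
      , ↭-refl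
      , (λ r → Isometry.preserves-CSet (inBlock q e r) (ρ-inBlock-same q e r) i cset)
      , (λ r s → at-distance))
    where
    part : Fin q → List (Vec Bool (q * (m + e)))
    part r = map (inBlock q e r) L
    lifted-weights : All (λ v → weight v ≡ h') (lift q e L)
    lifted-weights = lift-weights q e h+e≡h' weights
    bounded : ∀ {x y} → x ∈ lift q e L → y ∈ lift q e L → ρ x y ≤ h' + h'
    bounded {x} {y} x∈ y∈ = ≤-trans (ρ≤weight+weight x y)
      (≤-reflexive (cong₂ _+_ (All.lookup lifted-weights x∈) (All.lookup lifted-weights y∈)))
    at-distance : ∀ {r s} → r ≢ s → ∀ {x y} → x ∈ part r → y ∈ part s → IsDist t a p q (suc i) x y
    at-distance r≢s x∈ y∈ = trans (cong (_* a ^ (t ∸ suc i)) (lift-cross q e h+e≡h' weights r≢s x∈ y∈)) scale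
    disjoint : ∀ {r s} → r ≢ s → Disjoint (part r) (part s)
    disjoint r≢s {x} (x∈r , x∈s) =
      <⇒≢ (≤-trans 0<h' (m≤m+n h' h')) (trans (sym (ρ-self x)) (lift-cross q e h+e≡h' weights r≢s x∈r x∈s))
    w : Vec Bool m
    w = proj₁ (CSet-member i cset)
    w∈ : w ∈ L
    w∈ = proj₂ (CSet-member i cset)

  pad-CSet : ∀ {m q} n i h {L : List (Vec Bool m)} → h ≤ p → m + (p ∸ h) ≤ n →
             All (λ v → weight v ≡ h) L → IsCSet t a p q i L →
             ∃[ K ] (All (λ v → weight v ≡ p) K × IsCSet {n} t a p q i K)
  pad-CSet {m} n i h {L} h≤p fits weights cset with m≤n⇒∃[o]m+o≡n fits
  ... | l , m+k+l≡n =
    map pad L , All.map⁺ {f = pad} (All.map (λ {v} → padded-weight {v}) weights) ,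
    Isometry.preserves-CSet pad pad-iso i cset
    where
    k : ℕ
    k = p ∸ h
    padding : Vec Bool (k + l)
    padding = replicate k true ++ replicate l false
    fits-exactly : m + (k + l) ≡ n
    fits-exactly = trans (sym (+-assoc m k l)) m+k+l≡n
    pad : Vec Bool m → Vec Bool n
    pad v = subst (Vec Bool) fits-exactly (v ++ padding)
    pad-iso : ∀ u v → ρ (pad u) (pad v) ≡ ρ u v
    pad-iso u v = trans (ρ-subst fits-exactly _ _) (ρ-padʳ u v padding)
    padded-weight : ∀ {v} → weight v ≡ h → weight (pad v) ≡ p
    padded-weight {v} v≡h = begin
      weight (pad v)                ≡⟨ weight-subst fits-exactly (v ++ padding) ⟩
      weight (v ++ padding)         ≡⟨ weight-++ v padding ⟩
      weight v + weight padding     ≡⟨ cong₂ _+_ v≡h (weight-++ (replicate k true) (replicate l false)) ⟩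
      h + (weight (replicate k true) + weight (replicate l false))
                                    ≡⟨ cong (h +_) (cong₂ _+_ (weight-ones k) (weight-zeros l)) ⟩
      h + (k + 0)                   ≡⟨ cong (h +_) (+-identityʳ k) ⟩
      h + (p ∸ h)                   ≡⟨ m+[n∸m]≡n h≤p ⟩
      p                             ∎
      where open ≡-Reasoning

Σ1to : ℕ → (ℕ → ℕ) → ℕ
Σ1to zero    f = 0
Σ1to (suc k) f = Σ1to k f + f (suc k)

Σ1to-mono : ∀ f {m k} → m ≤ k → Σ1to m f ≤ Σ1to k f
Σ1to-mono f m≤k = go (≤⇒≤′ m≤k)
  where
  go : ∀ {m k} → m ≤′ k → Σ1to m f ≤ Σ1to k f
  go ≤′-refl        = ≤-refl
  go (≤′-step m≤′k) = ≤-trans (go m≤′k) (m≤m+n _ _)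

module Tower (c a' q₁ : ℕ) where

  a q : ℕ
  a = suc a'
  q = suc q₁

  h : ℕ → ℕ
  h j = c * a ^ j

  e : ℕ → ℕ
  e j = a' * h j

  h-suc : ∀ j → h (suc j) ≡ h j + e j
  h-suc j = distribute c a' (a ^ j)
    where
    distribute : ∀ c a' x → c * (suc a' * x) ≡ c * x + a' * (c * x)
    distribute = solve-∀

  h-pos : 0 < c → ∀ j → 0 < h j
  h-pos 0<c j = *-mono-< 0<c (m^n>0 a j)

  N : ℕ → ℕ
  N zero    = c
  N (suc j) = q * (N j + e j)

  W : ∀ j → List (Vec Bool (N j))
  W zero    = [ replicate c true ]
  W (suc j) = lift q (e j) (W j)

  -- D j = N j - h j, the length of level j beyond its weight; it grows by
  -- (q-1)·h (j+1) plus a factor q at each step.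
  D : ℕ → ℕ
  D zero    = 0
  D (suc j) = q * D j + q₁ * h (suc j)

  N≡h+D : ∀ j → N j ≡ h j + D j
  N≡h+D zero    = sym (trans (+-identityʳ (c * 1)) (*-identityʳ c))
  N≡h+D (suc j) = begin
    q * (N j + e j)                               ≡⟨ cong (λ n → q * (n + e j)) (N≡h+D j) ⟩
    q * (h j + D j + e j)                         ≡⟨ regroup q₁ (h j) (D j) (e j) ⟩
    (h j + e j) + (q * D j + q₁ * (h j + e j))    ≡⟨ cong (λ x → x + (q * D j + q₁ * x)) (sym (h-suc j)) ⟩
    h (suc j) + D (suc j)                         ∎
    where
    open ≡-Reasoning
    regroup : ∀ q₁ x d y → suc q₁ * (x + d + y) ≡ (x + y) + (suc q₁ * d + q₁ * (x + y))
    regroup = solve-∀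

  -- From here on the top level t is fixed; h t plays the role of p.
  module _ (t : ℕ) where

    h-scale : ∀ j → j ≤ t → h j * a ^ (t ∸ j) ≡ h t
    h-scale j j≤t = begin
      c * a ^ j * a ^ (t ∸ j)    ≡⟨ *-assoc c (a ^ j) (a ^ (t ∸ j)) ⟩
      c * (a ^ j * a ^ (t ∸ j))  ≡⟨ cong (c *_) (sym (^-distribˡ-+-* a j (t ∸ j))) ⟩
      c * a ^ (j + (t ∸ j))      ≡⟨ cong (λ k → c * a ^ k) (m+[n∸m]≡n j≤t) ⟩
      c * a ^ t                  ∎
      where open ≡-Reasoning

    h≤h : ∀ j → j ≤ t → h j ≤ h t
    h≤h j j≤t = ≤-trans (m≤m*n (h j) (a ^ (t ∸ j)) {{m^n≢0 a (t ∸ j)}}) (≤-reflexive (h-scale j j≤t))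

    open CSets t a (h t)

    tower : 2 ≤ q → 0 < c → ∀ j → j ≤ t → All (λ v → weight v ≡ h j) (W j) × IsCSet t a (h t) q j (W j)
    tower _   _   zero    _    = (trans (weight-ones c) (sym (*-identityʳ c)) ∷ []) , (_ , refl)
    tower 2≤q 0<c (suc j) sj≤t with tower 2≤q 0<c j (≤-trans (n≤1+n j) sj≤t)
    ... | weights , cset =
      lift-CSet j (e j) (h j) (h (suc j)) 2≤q (sym (h-suc j)) (h-pos 0<c (suc j)) scale weights cset
      where
      scale : (h (suc j) + h (suc j)) * a ^ (t ∸ suc j) ≡ 2 * h t
      scale = trans (double (h (suc j)) (a ^ (t ∸ suc j))) (cong (2 *_) (h-scale (suc j) sj≤t))
        where
        double : ∀ x y → (x + x) * y ≡ 2 * (x * y)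
        double = solve-∀

    -- G j = q^{t-j}·h j = p·(q/a)^{t-j}, the j-th term of the sum in hypothesis (4).
    G : ℕ → ℕ
    G j = q ^ (t ∸ j) * h j

    scaled-excess : ∀ j → j ≤ t → q ^ (t ∸ j) * D j ≡ q₁ * Σ1to j G
    scaled-excess zero    _    = trans (*-zeroʳ (q ^ t)) (sym (*-zeroʳ q₁))
    scaled-excess (suc j) sj≤t = begin
      q ^ k * (q * D j + q₁ * h (suc j))    ≡⟨ expand q (q ^ k) (D j) q₁ (h (suc j)) ⟩
      q ^ suc k * D j + q₁ * G (suc j)      ≡⟨ cong (λ l → q ^ l * D j + q₁ * G (suc j)) (sym t∸j≡1+k) ⟩
      q ^ (t ∸ j) * D j + q₁ * G (suc j)    ≡⟨ cong (_+ q₁ * G (suc j)) (scaled-excess j (≤-trans (n≤1+n j) sj≤t)) ⟩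
      q₁ * Σ1to j G + q₁ * G (suc j)        ≡⟨ sym (*-distribˡ-+ q₁ (Σ1to j G) (G (suc j))) ⟩
      q₁ * Σ1to (suc j) G                   ∎
      where
      open ≡-Reasoning
      k : ℕ
      k = t ∸ suc j
      t∸j≡1+k : t ∸ j ≡ suc k
      t∸j≡1+k = +-∸-assoc 1 sj≤t
      expand : ∀ q Q d q₁ x → Q * (q * d + q₁ * x) ≡ q * Q * d + q₁ * (Q * x)
      expand = solve-∀

    excess-bound : ∀ j → j ≤ t → D j ≤ q₁ * Σ1to t G
    excess-bound j j≤t = begin
      D j                   ≤⟨ m≤n*m (D j) (q ^ (t ∸ j)) {{m^n≢0 q (t ∸ j)}} ⟩
      q ^ (t ∸ j) * D j     ≡⟨ scaled-excess j j≤t ⟩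
      q₁ * Σ1to j G         ≤⟨ *-monoʳ-≤ q₁ (Σ1to-mono G j≤t) ⟩
      q₁ * Σ1to t G         ∎
      where open ≤-Reasoning

    dimension-bound : ∀ j → j ≤ t → N j + (h t ∸ h j) ≤ h t + q₁ * Σ1to t G
    dimension-bound j j≤t = begin
      N j + (h t ∸ h j)           ≡⟨ cong (_+ (h t ∸ h j)) (N≡h+D j) ⟩
      h j + D j + (h t ∸ h j)     ≡⟨ +-assoc (h j) (D j) (h t ∸ h j) ⟩
      h j + (D j + (h t ∸ h j))   ≡⟨ cong (h j +_) (+-comm (D j) (h t ∸ h j)) ⟩
      h j + ((h t ∸ h j) + D j)   ≡⟨ sym (+-assoc (h j) (h t ∸ h j) (D j)) ⟩
      h j + (h t ∸ h j) + D j     ≡⟨ cong (_+ D j) (m+[n∸m]≡n (h≤h j j≤t)) ⟩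
      h t + D j                   ≤⟨ +-monoʳ-≤ (h t) (excess-bound j j≤t) ⟩
      h t + q₁ * Σ1to t G         ∎
      where open ≤-Reasoning

-- ℕ → ℚ is a semiring homomorphism reflecting ≤; it is verified through the
-- unnormalised rationals, where the embedding ι m = m/1 computes.
ι : ℕ → ℚᵘ
ι m = mkℚᵘ (ℤ.+ m) 0

toℚ≃ι : ∀ m → toℚᵘ (toℚ m) ℚᵘ.≃ ι m
toℚ≃ι m = ℚ.toℚᵘ-fromℚᵘ (ι m)

ι-+ : ∀ m n → ι (m + n) ℚᵘ.≃ ι m ℚᵘ.+ ι n
ι-+ m n = *≡* (trans (cong (ℤ._* ℤ.+ 1) (ℤ.pos-+ m n)) (identity (ℤ.+ m) (ℤ.+ n)))
  where
  identity : ∀ x y → (x ℤ.+ y) ℤ.* ℤ.+ 1 ≡ (x ℤ.* ℤ.+ 1 ℤ.+ y ℤ.* ℤ.+ 1) ℤ.* ℤ.+ 1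
  identity = ℤ-Solver.solve-∀

ι-* : ∀ m n → ι (m * n) ℚᵘ.≃ ι m ℚᵘ.* ι n
ι-* m n = *≡* (cong (ℤ._* ℤ.+ 1) (ℤ.pos-* m n))

ι-inverse : ∀ q a' → ι (suc a') ℚᵘ.* mkℚᵘ (ℤ.+ q) a' ℚᵘ.≃ ι q
ι-inverse q a' =
  *≡* (trans (swap (ℤ.+ suc a') (ℤ.+ q)) (cong (λ d → ℤ.+ q ℤ.* ℤ.+ d) (sym (*-identityˡ (suc a')))))
  where
  swap : ∀ x y → (x ℤ.* y) ℤ.* ℤ.+ 1 ≡ y ℤ.* x
  swap = ℤ-Solver.solve-∀

toℚ-+ : ∀ m n → toℚ (m + n) ≡ toℚ m +ℚ toℚ n
toℚ-+ m n = ℚ.toℚᵘ-injective (begin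
  toℚᵘ (toℚ (m + n))              ≈⟨ toℚ≃ι (m + n) ⟩
  ι (m + n)                       ≈⟨ ι-+ m n ⟩
  ι m ℚᵘ.+ ι n                    ≈⟨ ℚᵘ.+-cong (ℚᵘ.≃-sym (toℚ≃ι m)) (ℚᵘ.≃-sym (toℚ≃ι n)) ⟩
  toℚᵘ (toℚ m) ℚᵘ.+ toℚᵘ (toℚ n)  ≈⟨ ℚᵘ.≃-sym (ℚ.toℚᵘ-homo-+ (toℚ m) (toℚ n)) ⟩
  toℚᵘ (toℚ m +ℚ toℚ n)           ∎)
  where open ℚᵘ.≃-Reasoning

toℚ-* : ∀ m n → toℚ (m * n) ≡ toℚ m *ℚ toℚ n
toℚ-* m n = ℚ.toℚᵘ-injective (begin
  toℚᵘ (toℚ (m * n))              ≈⟨ toℚ≃ι (m * n) ⟩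
  ι (m * n)                       ≈⟨ ι-* m n ⟩
  ι m ℚᵘ.* ι n                    ≈⟨ ℚᵘ.*-cong (ℚᵘ.≃-sym (toℚ≃ι m)) (ℚᵘ.≃-sym (toℚ≃ι n)) ⟩
  toℚᵘ (toℚ m) ℚᵘ.* toℚᵘ (toℚ n)  ≈⟨ ℚᵘ.≃-sym (ℚ.toℚᵘ-homo-* (toℚ m) (toℚ n)) ⟩
  toℚᵘ (toℚ m *ℚ toℚ n)           ∎)
  where open ℚᵘ.≃-Reasoning

fracℕ-inverse : ∀ q a' → toℚ (suc a') *ℚ fracℕ q (suc a') ≡ toℚ q
fracℕ-inverse q a' = ℚ.toℚᵘ-injective (begin
  toℚᵘ (toℚ (suc a') *ℚ fracℕ q (suc a'))           ≈⟨ ℚ.toℚᵘ-homo-* (toℚ (suc a')) (fracℕ q (suc a')) ⟩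
  toℚᵘ (toℚ (suc a')) ℚᵘ.* toℚᵘ (fracℕ q (suc a'))  ≈⟨ ℚᵘ.*-cong (toℚ≃ι (suc a')) (ℚ.toℚᵘ-fromℚᵘ (mkℚᵘ (ℤ.+ q) a')) ⟩
  ι (suc a') ℚᵘ.* mkℚᵘ (ℤ.+ q) a'                   ≈⟨ ι-inverse q a' ⟩
  ι q                                               ≈⟨ ℚᵘ.≃-sym (toℚ≃ι q) ⟩
  toℚᵘ (toℚ q)                                      ∎)
  where open ℚᵘ.≃-Reasoning

toℚ-cancel-≤ : ∀ {m n} → toℚ m ≤ℚ toℚ n → m ≤ n
toℚ-cancel-≤ {m} {n} le =
  ℤ.drop‿+≤+ (subst₂ ℤ._≤_ (ℤ.*-identityʳ (ℤ.+ m)) (ℤ.*-identityʳ (ℤ.+ n)) (ℚᵘ.drop-*≤* ι-le))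
  where
  ι-le : ι m ℚᵘ.≤ ι n
  ι-le = ℚᵘ.≤-respʳ-≃ (toℚ≃ι n) (ℚᵘ.≤-respˡ-≃ (toℚ≃ι m) (ℚ.toℚᵘ-mono-≤ le))

toℚ-^ : ∀ m k → toℚ (m ^ k) ≡ toℚ m ^ℚ k
toℚ-^ m zero    = refl
toℚ-^ m (suc k) = trans (toℚ-* m (m ^ k)) (cong (toℚ m *ℚ_) (toℚ-^ m k))

toℚ-pred : ∀ k → toℚ (suc k) -ℚ 1ℚ ≡ toℚ k
toℚ-pred k = trans (cong (_-ℚ 1ℚ) (toℚ-+ 1 k)) (solve 1 (λ x → (con 1ℚ :+ x) :- con 1ℚ := x) refl (toℚ k))
  where open +-*-Solver

^ℚ-distrib-*ℚ : ∀ x y k → (x *ℚ y) ^ℚ k ≡ x ^ℚ k *ℚ y ^ℚ k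
^ℚ-distrib-*ℚ x y zero    = sym (ℚ.*-identityˡ 1ℚ)
^ℚ-distrib-*ℚ x y (suc k) = trans (cong ((x *ℚ y) *ℚ_) (^ℚ-distrib-*ℚ x y k))
  (solve 4 (λ x y X Y → (x :* y) :* (X :* Y) := (x :* X) :* (y :* Y)) refl x y (x ^ℚ k) (y ^ℚ k))
  where open +-*-Solver

-- The term identity x·aᵏ·(q/a)ᵏ = qᵏ·x, used with x·a^{t-j} = p.
scaled-power : ∀ q a' x k → toℚ (x * suc a' ^ k) *ℚ fracℕ q (suc a') ^ℚ k ≡ toℚ (q ^ k * x)
scaled-power q a' x k = begin
  toℚ (x * a ^ k) *ℚ F ^ℚ k             ≡⟨ cong (_*ℚ F ^ℚ k) (trans (toℚ-* x (a ^ k)) (cong (toℚ x *ℚ_) (toℚ-^ a k))) ⟩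
  toℚ x *ℚ toℚ a ^ℚ k *ℚ F ^ℚ k         ≡⟨ ℚ.*-assoc (toℚ x) (toℚ a ^ℚ k) (F ^ℚ k) ⟩
  toℚ x *ℚ (toℚ a ^ℚ k *ℚ F ^ℚ k)       ≡⟨ cong (toℚ x *ℚ_) (sym (^ℚ-distrib-*ℚ (toℚ a) F k)) ⟩
  toℚ x *ℚ (toℚ a *ℚ F) ^ℚ k            ≡⟨ cong (λ y → toℚ x *ℚ y ^ℚ k) (fracℕ-inverse q a') ⟩
  toℚ x *ℚ toℚ q ^ℚ k                   ≡⟨ ℚ.*-comm (toℚ x) (toℚ q ^ℚ k) ⟩
  toℚ q ^ℚ k *ℚ toℚ x                   ≡⟨ cong (_*ℚ toℚ x) (sym (toℚ-^ q k)) ⟩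
  toℚ (q ^ k) *ℚ toℚ x                  ≡⟨ sym (toℚ-* (q ^ k) x) ⟩
  toℚ (q ^ k * x)                       ∎
  where
  open ≡-Reasoning
  a : ℕ
  a = suc a'
  F : ℚ
  F = fracℕ q a

sum1to-*ℚˡ : ∀ x k f → x *ℚ sum1to k f ≡ sum1to k (λ j → x *ℚ f j)
sum1to-*ℚˡ x zero    f = ℚ.*-zeroʳ x
sum1to-*ℚˡ x (suc k) f =
  trans (ℚ.*-distribˡ-+ x (sum1to k f) (f (suc k))) (cong (_+ℚ x *ℚ f (suc k)) (sum1to-*ℚˡ x k f))

sum1to-cong : ∀ k {f g : ℕ → ℚ} → (∀ j → j ≤ k → f j ≡ g j) → sum1to k f ≡ sum1to k g
sum1to-cong zero    f≗g = refl
sum1to-cong (suc k) f≗g = cong₂ _+ℚ_ (sum1to-cong k (λ j j≤k → f≗g j (m≤n⇒m≤1+n j≤k))) (f≗g (suc k) ≤-refl)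

toℚ-Σ1to : ∀ k f → toℚ (Σ1to k f) ≡ sum1to k (λ j → toℚ (f j))
toℚ-Σ1to zero    f = refl
toℚ-Σ1to (suc k) f = trans (toℚ-+ (Σ1to k f) (f (suc k))) (cong (_+ℚ toℚ (f (suc k))) (toℚ-Σ1to k f))

-- Hypothesis (4) in ℕ: its left-hand side is the natural number p + (q-1)·Σ G.
budget : ∀ c a' q₁ t → let open Tower c a' q₁ in
         toℚ (h t) +ℚ (toℚ (h t) *ℚ (toℚ q -ℚ 1ℚ) *ℚ sum1to t (λ j → fracℕ q a ^ℚ (t ∸ j)))
         ≡ toℚ (h t + q₁ * Σ1to t (G t))
budget c a' q₁ t = begin
  P +ℚ P *ℚ (toℚ q -ℚ 1ℚ) *ℚ S          ≡⟨ cong (λ y → P +ℚ P *ℚ y *ℚ S) (toℚ-pred q₁) ⟩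
  P +ℚ P *ℚ toℚ q₁ *ℚ S                 ≡⟨ solve 3 (λ P Q S → P :+ P :* Q :* S := P :+ Q :* (P :* S)) refl P (toℚ q₁) S ⟩
  P +ℚ toℚ q₁ *ℚ (P *ℚ S)               ≡⟨ cong (λ y → P +ℚ toℚ q₁ *ℚ y) weighted-sum ⟩
  P +ℚ toℚ q₁ *ℚ toℚ (Σ1to t (G t))     ≡⟨ sym (trans (toℚ-+ (h t) _) (cong (P +ℚ_) (toℚ-* q₁ _))) ⟩
  toℚ (h t + q₁ * Σ1to t (G t))         ∎
  where
  open Tower c a' q₁
  open ≡-Reasoning
  open +-*-Solver
  P S : ℚ
  P = toℚ (h t)
  S = sum1to t (λ j → fracℕ q a ^ℚ (t ∸ j))
  weighted-sum : P *ℚ S ≡ toℚ (Σ1to t (G t))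
  weighted-sum = begin
    P *ℚ S                                     ≡⟨ sum1to-*ℚˡ P t _ ⟩
    sum1to t (λ j → P *ℚ fracℕ q a ^ℚ (t ∸ j))  ≡⟨ sum1to-cong t term ⟩
    sum1to t (λ j → toℚ (G t j))               ≡⟨ sym (toℚ-Σ1to t (G t)) ⟩
    toℚ (Σ1to t (G t))                         ∎
    where
    term : ∀ j → j ≤ t → P *ℚ fracℕ q a ^ℚ (t ∸ j) ≡ toℚ (G t j)
    term j j≤t = trans (cong (λ n → toℚ n *ℚ fracℕ q a ^ℚ (t ∸ j)) (sym (h-scale t j j≤t)))
                       (scaled-power q a' (h j) (t ∸ j))

-- q ≥ 2: otherwise qᵗ = 1 < λ^p.
power>1 : ∀ {x} → 1ℚ <ℚ x → ∀ k → 1ℚ <ℚ x ^ℚ suc k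
power>1 {x} 1<x zero    = subst (1ℚ <ℚ_) (sym (ℚ.*-identityʳ x)) 1<x
power>1 {x} 1<x (suc k) =
  ℚ.<-trans 1<x (subst (_<ℚ x *ℚ (x ^ℚ suc k)) (ℚ.*-identityʳ x) (ℚ.*-monoʳ-<-pos x {{x>0}} (power>1 1<x k)))
  where
  x>0 : Positive x
  x>0 = positive (ℚ.<-trans (ℚ.positive⁻¹ 1ℚ) 1<x)

two≤q : ∀ {x} k q₁ t → 1ℚ <ℚ x → 0 < k → x ^ℚ k ≤ℚ toℚ (suc q₁ ^ t) → 2 ≤ suc q₁
two≤q (suc k) zero     t 1<x _ xᵏ≤1ᵗ =
  ⊥-elim (ℚ.<-irrefl refl (ℚ.<-≤-trans (power>1 1<x k) (subst (λ m → _ ≤ℚ toℚ m) (^-zeroˡ t) xᵏ≤1ᵗ)))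
two≤q k       (suc q₂) t _   _ _     = s≤s (s≤s z≤n)

lemma1 : (C α λ' : ℚ) (t a p q n : ℕ) →
    1ℚ ≤ℚ C → 0ℚ <ℚ α → α ≤ℚ 1ℚ → 1ℚ <ℚ λ' →
    0 < t → 0 < a → 0 < p → 0 < q → 0 < n →
    fracℕ 1 t <ℚ α → C <ℚ toℚ a →
    a ^ t ∣ p →
    λ' ^ℚ p ≤ℚ toℚ (q ^ t) →
    toℚ p +ℚ (toℚ p *ℚ (toℚ q -ℚ 1ℚ) *ℚ sum1to t (λ j → fracℕ q a ^ℚ (t ∸ j))) ≤ℚ toℚ n →
    (i : ℕ) → 1 ≤ i → i ≤ t →
    ∃[ K ] (All (λ v → weight v ≡ p) K × IsCSet {n} t a p q i K)
lemma1 C α λ' t (suc a') p (suc q₁) n _ _ _ 1<λ _ (s≤s z≤n) 0<p (s≤s z≤n) _ _ _ (divides c refl) λᵖ≤qᵗ room i _ i≤t =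
  let weights , cset = tower t 2≤q 0<c i i≤t
  in  pad-CSet n i (h i) (h≤h t i i≤t) (≤-trans (dimension-bound t i i≤t) length-budget) weights cset
  where
  open Tower c a' q₁
  open CSets t a (h t)
  0<c : 0 < c
  0<c = >-nonZero⁻¹ c {{m*n≢0⇒m≢0 c {{>-nonZero 0<p}}}}
  2≤q : 2 ≤ q
  2≤q = two≤q (h t) q₁ t 1<λ 0<p λᵖ≤qᵗ
  length-budget : h t + q₁ * Σ1to t (G t) ≤ n
  length-budget = toℚ-cancel-≤ (subst (_≤ℚ toℚ n) (budget c a' q₁ t) room)
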